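{- Let $k \geq 2$ be an integer and let $G$ be a graph on $n$ vertices with girth at least $2k$ and minimum degree $\delta$. Let $T \subset V(G)$ be such that every pair of non-adjacent vertices of $T$ has distance at least $2k-1$ in $G$. Then $n \geq |T|\delta(\delta-1)^{k-2}$. Moreover, if $|T|$ is odd, then $n \geq |T|\delta(\delta-1)^{k-2}+1$.
   Context: Graphs are finite and simple; $d$ denotes graph distance. The girth of a graph is the length of its shortest cycle (infinite if acyclic). -}

module Defs where

open import Data.Nat using (ℕ; zero; suc; _+_; _≤_; _<_)
open import Data.Bool using (Bool; true; false; if_then_else_)
open import Data.Fin using (Fin; zero; suc; inject₁; fromℕ)
open import Data.List using (List; map)
open import Data.Nat.ListAction using (sum)
open import Data.List.Base using (allFin)
open import Data.Product using (_×_; ∃-syntax)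
open import Relation.Binary.PropositionalEquality using (_≡_; _≢_)
open import Relation.Nullary using (¬_)
open import Function.Definitions using (Injective)

record Graph (n : ℕ) : Set where
  field
    adj   : Fin n → Fin n → Bool
    sym   : ∀ u v → adj u v ≡ adj v u
    irrefl : ∀ v → adj v v ≡ false

open Graph public

_~[_]_ : ∀ {n} → Fin n → Graph n → Fin n → Set
u ~[ G ] v = adj G u v ≡ true

deg : ∀ {n} → Graph n → Fin n → ℕ
deg {n} G v = sum (map (λ u → if adj G v u then 1 else 0) (allFin n))

IsMinDegree : ∀ {n} → Graph n → ℕ → Set
IsMinDegree G δ = (∀ v → δ ≤ deg G v) × (∃[ v ] deg G v ≡ δ)

record Cycle {n : ℕ} (G : Graph n) (p : ℕ) : Set where
  field
    long  : 3 ≤ suc p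
    vert  : Fin (suc p) → Fin n
    inj   : Injective _≡_ _≡_ vert
    step  : ∀ (i : Fin p) → vert (inject₁ i) ~[ G ] vert (suc i)
    close : vert (fromℕ p) ~[ G ] vert zero

GirthAtLeast : ∀ {n} → Graph n → ℕ → Set
GirthAtLeast G g = ∀ p → Cycle G p → g ≤ suc p

data Walk {n : ℕ} (G : Graph n) : Fin n → Fin n → ℕ → Set where
  nil  : ∀ {u} → Walk G u u 0
  cons : ∀ {u w v ℓ} → u ~[ G ] w → Walk G w v ℓ → Walk G u v (suc ℓ)

DistAtLeast : ∀ {n} → Graph n → Fin n → Fin n → ℕ → Set
DistAtLeast G u v r = ∀ ℓ → ℓ < r → ¬ Walk G u v ℓ

-- Fix t ∈ T. Non-backtracking walks of length k − 1 from t are paths (girth ≥ 2k), there are at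
-- least δ(δ − 1)^(k−2) of them, and their end vertices are distinct, since two distinct paths with
-- common ends contain a cycle of length at most their total length 2k − 2. These sets of end
-- vertices are pairwise disjoint for distinct t, t′ ∈ T: for non-adjacent t, t′ a common vertex
-- yields a walk of length 2k − 2 < 2k − 1 between them; for adjacent ones it yields two paths of
-- different lengths at most k to t′, closing a cycle of length at most 2k − 1. If |T| is odd, some
-- t₀ ∈ T has no neighbour in T, for otherwise every vertex of T has exactly one neighbour in T (two
-- would form a triangle or lie at distance 2) and T would be perfectly matched; such a t₀ is an end
-- vertex of none of these walks, which gives the extra vertex.

module Submission where

open import Defs hiding (sym)

open import Data.Bool using (Bool; true; false; if_then_else_)
import Data.Bool as Bool
open import Data.Bool.Properties using (T-≡; ¬-not)
open import Data.Empty using (⊥-elim)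
open import Data.Fin using (Fin; zero; suc; inject₁; fromℕ; _≟_)
open import Data.Fin.Properties using (injective⇒≤; suc-injective)
open import Data.Fin.Subset using (Subset; ∣_∣) renaming (_∈_ to _∈ₛ_)
open import Data.List
  using (List; []; _∷_; _++_; [_]; length; head; lookup; map; concatMap; filter; filterᵇ; allFin)
import Data.List.Membership.DecPropositional as DecMembership
open import Data.List.Membership.Propositional using (_∈_; _∉_; find; lose)
open import Data.List.Membership.Propositional.Properties
  using (∈-map⁻; ∈-lookup; ∈-∃++; ∈-filter⁻; ∈-concatMap⁻)
open import Data.List.Properties using (length-++; length-map; filter-all; ∷-injectiveˡ; ∷-injectiveʳ)
open import Data.List.Relation.Binary.Disjoint.Propositional using (Disjoint)
open import Data.List.Relation.Binary.Permutation.Propositional using (_↭_; prep; ↭-sym; ↭⇒↭ₛ)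
open import Data.List.Relation.Binary.Permutation.Propositional.Properties
  using (shift; ∈-resp-↭; ↭-length)
import Data.List.Relation.Binary.Permutation.Setoid.Properties as Permutationₛ
open import Data.List.Relation.Unary.All as All using (All; []; _∷_; all?)
import Data.List.Relation.Unary.All.Properties as Allₚ
open import Data.List.Relation.Unary.AllPairs as AllPairs using (AllPairs; []; _∷_)
import Data.List.Relation.Unary.AllPairs.Properties as AllPairsₚ
open import Data.List.Relation.Unary.Any using (here; there; any?)
open import Data.List.Relation.Unary.Linked as Linked using (Linked; []; [-]; _∷_)
open import Data.List.Relation.Unary.Unique.Propositional using (Unique)
import Data.List.Relation.Unary.Unique.Propositional.Properties as Uniqueₚ
open import Data.Maybe using (just)
open import Data.Maybe.Properties using (just-injective)
open import Data.Nat using (ℕ; zero; suc; _+_; _*_; _∸_; _^_; _%_; _≤_; _<_; z≤n; s≤s)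
open import Data.Nat.ListAction using (sum)
open import Data.Nat.Properties
  using ( ≤-refl; ≤-reflexive; ≤-trans; <⇒≤; <⇒≢; <⇒≱; n≤1+n; m≤m+n; m≤n+m; m∸n≤m; 1+n≢n
        ; +-comm; +-suc; +-identityʳ; +-mono-≤; *-comm; *-assoc; *-monoˡ-≤; ∸-monoˡ-≤
        ; module ≤-Reasoning )
  renaming (suc-injective to ℕ-suc-injective)
open import Data.Product using (∃-syntax; _×_; _,_; proj₁; proj₂)
open import Data.Vec using ([]; _∷_; here; there)
open import Function using (_∘_)
open import Function.Bundles using (Equivalence)
open import Function.Definitions using (Injective)
open import Relation.Binary.Definitions using (DecidableEquality; Symmetric)
open import Relation.Binary.PropositionalEquality
  using (_≡_; _≢_; refl; sym; trans; cong; cong₂; subst; subst₂; setoid)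
open import Relation.Nullary using (¬_; contradiction; yes; no)
open import Relation.Nullary.Decidable using (¬?; T?)

module _ {A : Set} where

  lastOf : A → List A → A
  lastOf x []       = x
  lastOf _ (y ∷ ys) = lastOf y ys

  lastOf-∈ : ∀ x ys → lastOf x ys ∈ x ∷ ys
  lastOf-∈ x []       = here refl
  lastOf-∈ x (y ∷ ys) = there (lastOf-∈ y ys)

  lastOf-++ : ∀ x ys z → lastOf x (ys ++ [ z ]) ≡ z
  lastOf-++ x []       z = refl
  lastOf-++ x (y ∷ ys) z = lastOf-++ y ys z

  length-∷ʳ : ∀ (xs : List A) {y} → length (xs ++ [ y ]) ≡ suc (length xs)
  length-∷ʳ []       = refl
  length-∷ʳ (x ∷ xs) = cong suc (length-∷ʳ xs)

  length-prefix-≤ : ∀ (xs : List A) {y zs} → length (xs ++ [ y ]) ≤ length (xs ++ y ∷ zs)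
  length-prefix-≤ []       = s≤s z≤n
  length-prefix-≤ (x ∷ xs) = s≤s (length-prefix-≤ xs)

  length-prefix-< : ∀ (xs : List A) {y z zs} → length (xs ++ [ y ]) < length (xs ++ y ∷ z ∷ zs)
  length-prefix-< []       = s≤s (s≤s z≤n)
  length-prefix-< (x ∷ xs) = s≤s (length-prefix-< xs)

  Unique-∷ : ∀ {x : A} {xs} → x ∉ xs → Unique xs → Unique (x ∷ xs)
  Unique-∷ {xs = xs} x∉xs xs! = Allₚ.¬Any⇒All¬ xs x∉xs ∷ xs!

  Unique-∷ʳ : ∀ {xs} {x : A} → Unique xs → x ∉ xs → Unique (xs ++ [ x ])
  Unique-∷ʳ {[]}     _          _    = [] ∷ []
  Unique-∷ʳ {y ∷ xs} (y∉ ∷ xs!) x∉ =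
    Allₚ.++⁺ y∉ ((λ y≡x → x∉ (here (sym y≡x))) ∷ []) ∷ Unique-∷ʳ xs! (x∉ ∘ there)

  Unique-prefix : ∀ (xs : List A) {y zs} → Unique (xs ++ y ∷ zs) → Unique (xs ++ [ y ])
  Unique-prefix []       _           = [] ∷ []
  Unique-prefix (x ∷ xs) (x∉ ∷ xs!) =
    Allₚ.++⁺ (Allₚ.++⁻ˡ xs x∉) (All.head (Allₚ.++⁻ʳ xs x∉) ∷ []) ∷ Unique-prefix xs xs!

  Unique-lastOf : ∀ {x : A} {ys} → Unique (x ∷ ys) → lastOf x ys ≡ x → ys ≡ []
  Unique-lastOf {ys = []}     _          _  = refl
  Unique-lastOf {ys = y ∷ ys} (x∉ ∷ _) eq =
    contradiction (sym eq) (All.lookup x∉ (lastOf-∈ y ys))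

  lookup-injective : ∀ {xs : List A} → Unique xs → Injective _≡_ _≡_ (lookup xs)
  lookup-injective {x ∷ xs} _         {zero}  {zero}  _  = refl
  lookup-injective {x ∷ xs} (x∉ ∷ _)  {zero}  {suc j} eq = contradiction eq (All.lookup x∉ (∈-lookup j))
  lookup-injective {x ∷ xs} (x∉ ∷ _)  {suc i} {zero}  eq = contradiction (sym eq) (All.lookup x∉ (∈-lookup i))
  lookup-injective {x ∷ xs} (_ ∷ xs!) {suc i} {suc j} eq = cong suc (lookup-injective xs! eq)

  lookup-fromℕ : ∀ x xs → lookup (x ∷ xs) (fromℕ (length xs)) ≡ lastOf x xs
  lookup-fromℕ x []       = refl
  lookup-fromℕ x (y ∷ xs) = lookup-fromℕ y xs

  module _ {R : A → A → Set} where

    Linked-∷ʳ : ∀ {x xs y} → Linked R (x ∷ xs) → R (lastOf x xs) y → Linked R (x ∷ xs ++ [ y ])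
    Linked-∷ʳ [-]       r = r ∷ [-]
    Linked-∷ʳ (r′ ∷ rs) r = r′ ∷ Linked-∷ʳ rs r

    Linked-prefix : ∀ xs {y zs} → Linked R (xs ++ y ∷ zs) → Linked R (xs ++ [ y ])
    Linked-prefix []            _        = [-]
    Linked-prefix (x ∷ [])      (r ∷ _)  = r ∷ [-]
    Linked-prefix (x ∷ x′ ∷ xs) (r ∷ rs) = r ∷ Linked-prefix (x′ ∷ xs) rs

    Linked-lookup : ∀ {x xs} → Linked R (x ∷ xs) → (i : Fin (length xs)) →
                    R (lookup (x ∷ xs) (inject₁ i)) (lookup (x ∷ xs) (suc i))
    Linked-lookup (r ∷ _)  zero    = r
    Linked-lookup (_ ∷ rs) (suc i) = Linked-lookup rs i

  length-filterᵇ : ∀ (p : A → Bool) xs →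
                   length (filterᵇ p xs) ≡ sum (map (λ x → if p x then 1 else 0) xs)
  length-filterᵇ p []       = refl
  length-filterᵇ p (x ∷ xs) with p x
  ... | true  = cong suc (length-filterᵇ p xs)
  ... | false = length-filterᵇ p xs

  length-filter-≢ : ∀ (_≟_ : DecidableEquality A) y {xs} → Unique xs →
                    length xs ≤ suc (length (filter (λ x → ¬? (x ≟ y)) xs))
  length-filter-≢ _≟_ y {[]}     _           = z≤n
  length-filter-≢ _≟_ y {x ∷ xs} (x∉ ∷ xs!) with x ≟ y
  ... | yes refl = s≤s (≤-reflexive (cong length (sym (filter-all _ (All.map (_∘ sym) x∉)))))
  ... | no  _    = s≤s (length-filter-≢ _≟_ y xs!)

  AllPairs-map∈ : ∀ {R S : A → A → Set} {xs} → (∀ {x y} → x ∈ xs → y ∈ xs → R x y → S x y) →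
                  AllPairs R xs → AllPairs S xs
  AllPairs-map∈ f []         = []
  AllPairs-map∈ f (rs ∷ rss) =
    All.tabulate (λ y∈ → f (here refl) (there y∈) (All.lookup rs y∈)) ∷
    AllPairs-map∈ (λ x∈ y∈ → f (there x∈) (there y∈)) rss

module _ {A B : Set} where

  length-concatMap-≥ : ∀ (f : A → List B) {xs c} → (∀ {x} → x ∈ xs → c ≤ length (f x)) →
                       length xs * c ≤ length (concatMap f xs)
  length-concatMap-≥ f {[]}     _ = z≤n
  length-concatMap-≥ f {x ∷ xs} b = subst (_ ≤_) (sym (length-++ (f x)))
    (+-mono-≤ (b (here refl)) (length-concatMap-≥ f (b ∘ there)))

Unique⇒length≤ : ∀ {n} {xs : List (Fin n)} → Unique xs → length xs ≤ n
Unique⇒length≤ xs! = injective⇒≤ (lookup-injective xs!)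

elements : ∀ {n} → Subset n → List (Fin n)
elements []          = []
elements (true ∷ p)  = zero ∷ map suc (elements p)
elements (false ∷ p) = map suc (elements p)

length-elements : ∀ {n} (p : Subset n) → length (elements p) ≡ ∣ p ∣
length-elements []          = refl
length-elements (true ∷ p)  = cong suc (trans (length-map suc (elements p)) (length-elements p))
length-elements (false ∷ p) = trans (length-map suc (elements p)) (length-elements p)

∈-elements⁻ : ∀ {n} (p : Subset n) {x} → x ∈ elements p → x ∈ₛ p
∈-elements⁻ (true ∷ p)  (here refl) = here
∈-elements⁻ (true ∷ p)  (there x∈) with _ , y∈ , refl ← ∈-map⁻ suc x∈ = there (∈-elements⁻ p y∈)
∈-elements⁻ (false ∷ p) x∈          with _ , y∈ , refl ← ∈-map⁻ suc x∈ = there (∈-elements⁻ p y∈)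

elements-unique : ∀ {n} (p : Subset n) → Unique (elements p)
elements-unique []          = []
elements-unique (true ∷ p)  = Unique-∷ zero∉ (Uniqueₚ.map⁺ suc-injective (elements-unique p))
  where
  zero∉ : zero ∉ map suc (elements p)
  zero∉ z∈ with () ← ∈-map⁻ suc z∈
elements-unique (false ∷ p) = Uniqueₚ.map⁺ suc-injective (elements-unique p)

module _ {A : Set} (R : A → A → Set) where

  record PerfectlyMatched (xs : List A) : Set where
    field
      partner        : ∀ {x} → x ∈ xs → ∃[ y ] y ∈ xs × R x y
      partner-unique : ∀ {x y z} → x ∈ xs → y ∈ xs → z ∈ xs → R x y → R x z → y ≡ z

  open PerfectlyMatched

  PerfectlyMatched-resp-↭ : ∀ {xs ys} → xs ↭ ys → PerfectlyMatched xs → PerfectlyMatched ys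
  PerfectlyMatched-resp-↭ {xs} {ys} π pm = record
    { partner        = λ x∈ → let y , y∈ , rxy = partner pm (back x∈) in y , ∈-resp-↭ π y∈ , rxy
    ; partner-unique = λ x∈ y∈ z∈ → partner-unique pm (back x∈) (back y∈) (back z∈)
    }
    where
    back : ∀ {z} → z ∈ ys → z ∈ xs
    back = ∈-resp-↭ (↭-sym π)

  PerfectlyMatched-dropPair : Symmetric R → ∀ {x y zs} → Unique (x ∷ y ∷ zs) → R x y →
                              PerfectlyMatched (x ∷ y ∷ zs) → PerfectlyMatched zs
  PerfectlyMatched-dropPair R-sym {x} {y} {zs} (x∉ ∷ y∉ ∷ _) rxy pm = record
    { partner        = partner′
    ; partner-unique = λ a∈ b∈ c∈ → partner-unique pm (inner a∈) (inner b∈) (inner c∈)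
    }
    where
    inner : ∀ {z} → z ∈ zs → z ∈ x ∷ y ∷ zs
    inner z∈ = there (there z∈)
    partner′ : ∀ {z} → z ∈ zs → ∃[ w ] w ∈ zs × R z w
    partner′ z∈ with partner pm (inner z∈)
    ... | w , there (there w∈) , rzw = w , w∈ , rzw
    ... | _ , here refl , rzx =
      contradiction (partner-unique pm (here refl) (there (here refl)) (inner z∈) rxy (R-sym rzx))
                    (All.lookup y∉ z∈)
    ... | _ , there (here refl) , rzy =
      contradiction (partner-unique pm (there (here refl)) (here refl) (inner z∈) (R-sym rxy) (R-sym rzy))
                    (All.lookup (All.tail x∉) z∈)

  PerfectlyMatched⇒even : Symmetric R → (∀ {x} → ¬ R x x) →
                          ∀ {xs} → Unique xs → PerfectlyMatched xs → length xs % 2 ≡ 0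
  PerfectlyMatched⇒even R-sym R-irrefl xs! = even _ refl xs!
    where
    open Permutationₛ (setoid A) using (Unique-resp-↭)
    even : ∀ m {xs} → length xs ≡ m → Unique xs → PerfectlyMatched xs → m % 2 ≡ 0
    even zero                 _  _   _  = refl
    even (suc zero)    {x ∷ []} _ _ pm with partner pm (here refl)
    ... | _ , here refl , rxx = contradiction rxx R-irrefl
    even (suc (suc m)) {x ∷ xs} len xs! pm with partner pm (here refl)
    ... | _ , here refl , rxx = contradiction rxx R-irrefl
    ... | y , there y∈ , rxy with ys₁ , ys₂ , refl ← ∈-∃++ y∈ =
      even m (ℕ-suc-injective (ℕ-suc-injective (trans (sym (↭-length π)) len)))
        (AllPairs.tail (AllPairs.tail xy!))
        (PerfectlyMatched-dropPair R-sym xy! rxy (PerfectlyMatched-resp-↭ π pm))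
      where
      π : x ∷ ys₁ ++ y ∷ ys₂ ↭ x ∷ y ∷ ys₁ ++ ys₂
      π = prep x (shift y ys₁ ys₂)
      xy! : Unique (x ∷ y ∷ ys₁ ++ ys₂)
      xy! = Unique-resp-↭ (↭⇒↭ₛ π) xs!

module GraphPaths {n : ℕ} (G : Graph n) where

  V : Set
  V = Fin n

  open DecMembership (_≟_ {n}) using (_∈?_)

  _~_ : V → V → Set
  u ~ v = u ~[ G ] v

  ~-sym : ∀ {u v} → u ~ v → v ~ u
  ~-sym {u} {v} u~v = trans (Graph.sym G v u) u~v

  ~-irrefl : ∀ {u} → ¬ u ~ u
  ~-irrefl {u} u~u with () ← trans (sym u~u) (Graph.irrefl G u)

  IsPath : List V → Set
  IsPath xs = Unique xs × Linked _~_ xs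

  IsPath-tail : ∀ {x xs} → IsPath (x ∷ xs) → IsPath xs
  IsPath-tail (_ ∷ xs! , l) = xs! , Linked.tail l

  IsPath-prefix : ∀ xs {y zs} → IsPath (xs ++ y ∷ zs) → IsPath (xs ++ [ y ])
  IsPath-prefix xs (xs! , l) = Unique-prefix xs xs! , Linked-prefix xs l

  Linked⇒Walk : ∀ {x r} → Linked _~_ (x ∷ r) → Walk G x (lastOf x r) (length r)
  Linked⇒Walk [-]      = nil
  Linked⇒Walk (e ∷ es) = cons e (Linked⇒Walk es)

  Walk-snoc : ∀ {u v w ℓ} → Walk G u v ℓ → v ~ w → Walk G u w (suc ℓ)
  Walk-snoc nil         e = cons e nil
  Walk-snoc (cons e′ p) e = cons e′ (Walk-snoc p e)

  Walk-reverse : ∀ {u v ℓ} → Walk G u v ℓ → Walk G v u ℓ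
  Walk-reverse nil        = nil
  Walk-reverse (cons e p) = Walk-snoc (Walk-reverse p) (~-sym e)

  Walk-++ : ∀ {u v w ℓ m} → Walk G u v ℓ → Walk G v w m → Walk G u w (ℓ + m)
  Walk-++ nil        q = q
  Walk-++ (cons e p) q = cons e (Walk-++ p q)

  path-to-neighbour : ∀ {w r t} → IsPath (w ∷ r) → lastOf w r ~ t →
    ∃[ r′ ] IsPath (w ∷ r′) × lastOf w r′ ≡ t × length r′ ≢ length r × length r′ ≤ suc (length r)
  path-to-neighbour {w} {r} {t} (w∷r! , l) e with t ∈? w ∷ r
  ... | no t∉ = r ++ [ t ] , (Unique-∷ʳ w∷r! t∉ , Linked-∷ʳ l e) , lastOf-++ w r t ,
                 (λ eq → 1+n≢n (trans (sym (length-∷ʳ r)) eq)) , ≤-reflexive (length-∷ʳ r)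
  ... | yes (here refl) = [] , ([] ∷ [] , [-]) , refl , 0≢length r e , z≤n
    where
    0≢length : ∀ r → lastOf w r ~ w → 0 ≢ length r
    0≢length []      w~w = contradiction w~w ~-irrefl
    0≢length (_ ∷ _) _   ()
  ... | yes (there t∈) with r₁ , r₂ , refl ← ∈-∃++ t∈ with r₂
  ...   | [] = contradiction (subst (_~ t) (lastOf-++ w r₁ t) e) ~-irrefl
  ...   | _ ∷ _ = r₁ ++ [ t ] , IsPath-prefix (w ∷ r₁) (w∷r! , l) , lastOf-++ w r₁ t ,
                  <⇒≢ (length-prefix-< r₁) , ≤-trans (<⇒≤ (length-prefix-< r₁)) (n≤1+n _)

  module _ {g : ℕ} (girth : GirthAtLeast G g) where

    cycle-bound : ∀ {v ys} → IsPath (v ∷ ys) → lastOf v ys ~ v → 2 ≤ length ys → g ≤ suc (length ys)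
    cycle-bound {v} {ys} (v∷ys! , l) close 2≤ = girth (length ys) record
      { long  = s≤s 2≤
      ; vert  = lookup (v ∷ ys)
      ; inj   = lookup-injective v∷ys!
      ; step  = Linked-lookup l
      ; close = subst (_~ v) (sym (lookup-fromℕ v ys)) close
      }

    triangle-bound : ∀ {x y z} → x ~ y → y ~ z → z ~ x → g ≤ 3
    triangle-bound {x} {y} {z} x~y y~z z~x =
      cycle-bound (Unique-∷ x∉ (Unique-∷ y∉ ([] ∷ [])) , x~y ∷ y~z ∷ [-]) z~x ≤-refl
      where
      x∉ : x ∉ y ∷ z ∷ []
      x∉ (here refl)         = ~-irrefl x~y
      x∉ (there (here refl)) = ~-irrefl z~x
      y∉ : y ∉ z ∷ []
      y∉ (here refl) = ~-irrefl y~z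

    chord-bound : ∀ {v q x} → IsPath (v ∷ q) → v ~ x → x ∈ q → head q ≢ just x → g ≤ suc (length q)
    chord-bound {v} {q} {x} P v~x x∈q fresh with q₁ , q₂ , refl ← ∈-∃++ x∈q with q₁
    ... | []      = contradiction refl fresh
    ... | y ∷ q₁′ = ≤-trans (cycle-bound (IsPath-prefix (v ∷ y ∷ q₁′) P) closing two)
                            (s≤s (length-prefix-≤ (y ∷ q₁′)))
      where
      closing : lastOf v (y ∷ q₁′ ++ [ x ]) ~ v
      closing = subst (_~ v) (sym (lastOf-++ v (y ∷ q₁′) x)) (~-sym v~x)
      two : 2 ≤ length (y ∷ q₁′ ++ [ x ])
      two = s≤s (subst (1 ≤_) (sym (length-∷ʳ q₁′)) (s≤s z≤n))

    path-extension : ∀ {x r u} → IsPath (x ∷ r) → x ~ u → head r ≢ just u → suc (length r) < g →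
                     IsPath (u ∷ x ∷ r)
    path-extension {x} {r} {u} P@(x∷r! , l) x~u fresh short = Unique-∷ u∉ x∷r! , ~-sym x~u ∷ l
      where
      u∉ : u ∉ x ∷ r
      u∉ (here refl) = ~-irrefl x~u
      u∉ (there u∈) = <⇒≱ short (chord-bound P x~u u∈ fresh)

    -- If x lies on the second path it closes a cycle through v; otherwise start both paths at x,
    -- with v prepended to the second one.
    crossing-paths-bound : ∀ {v x y p q w} → IsPath (v ∷ x ∷ p) → IsPath (v ∷ y ∷ q) → x ≢ y →
                           w ∈ x ∷ p → w ∈ y ∷ q → g ≤ length (x ∷ p) + length (y ∷ q)
    crossing-paths-bound {v} {x} {y} {p} {q} P@(v∉ ∷ _ , v~x ∷ _) Q x≢y w∈p w∈q with x ∈? y ∷ q | w∈p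
    ... | yes x∈q | _ =
      ≤-trans (chord-bound Q v~x x∈q (x≢y ∘ sym ∘ just-injective)) (s≤s (m≤n+m _ (length p)))
    ... | no x∉q | here refl = contradiction w∈q x∉q
    ... | no x∉q | there {xs = z ∷ p′} w∈p′ =
      subst (g ≤_) (cong suc (+-suc (length p′) (suc (length q))))
        (crossing-paths-bound (IsPath-tail P) Q′ z≢v w∈p′ (there w∈q))
      where
      x∉vq : x ∉ v ∷ y ∷ q
      x∉vq (here x≡v) = All.head v∉ (sym x≡v)
      x∉vq (there x∈) = x∉q x∈
      Q′ : IsPath (x ∷ v ∷ y ∷ q)
      Q′ = Unique-∷ x∉vq (proj₁ Q) , ~-sym v~x ∷ proj₂ Q
      z≢v : z ≢ v
      z≢v z≡v = All.lookup v∉ (there (here refl)) (sym z≡v)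
    parallel-paths-bound : ∀ {v p q} → IsPath (v ∷ p) → IsPath (v ∷ q) →
                           lastOf v p ≡ lastOf v q → p ≢ q → g ≤ length p + length q
    parallel-paths-bound {p = []}    {[]}    _          _          _  p≢q = contradiction refl p≢q
    parallel-paths-bound {p = []}    {_ ∷ _} _          (v∷q! , _) eq _
      with () ← Unique-lastOf v∷q! (sym eq)
    parallel-paths-bound {p = _ ∷ _} {[]}    (v∷p! , _) _          eq _
      with () ← Unique-lastOf v∷p! eq
    parallel-paths-bound {p = x ∷ p} {y ∷ q} P Q eq p≢q with x ≟ y
    ... | yes refl =
      ≤-trans (parallel-paths-bound (IsPath-tail P) (IsPath-tail Q) eq (p≢q ∘ cong (x ∷_)))
              (+-mono-≤ (n≤1+n _) (n≤1+n _))
    ... | no x≢y = crossing-paths-bound P Q x≢y (lastOf-∈ x p) (subst (_∈ y ∷ q) (sym eq) (lastOf-∈ y q))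

module NonBacktracking {n : ℕ} (G : Graph n) (δ : ℕ) (minDeg : ∀ v → δ ≤ deg G v) where

  open GraphPaths G

  neighbours : V → List V
  neighbours x = filterᵇ (adj G x) (allFin n)

  neighbours-unique : ∀ x → Unique (neighbours x)
  neighbours-unique x = Uniqueₚ.filter⁺ (T? ∘ adj G x) (Uniqueₚ.allFin⁺ n)

  ∈-neighbours⁻ : ∀ {x u} → u ∈ neighbours x → x ~ u
  ∈-neighbours⁻ {x} u∈ = Equivalence.to T-≡ (proj₂ (∈-filter⁻ (T? ∘ adj G x) {xs = allFin n} u∈))

  δ≤length-neighbours : ∀ x → δ ≤ length (neighbours x)
  δ≤length-neighbours x = subst (δ ≤_) (sym (length-filterᵇ (adj G x) (allFin n))) (minDeg x)

  successors : V → List V → List V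
  successors x []      = neighbours x
  successors x (y ∷ _) = filter (λ u → ¬? (u ≟ y)) (neighbours x)

  ∈-successors⁻ : ∀ {x r u} → u ∈ successors x r → x ~ u × head r ≢ just u
  ∈-successors⁻ {r = []}    u∈ = ∈-neighbours⁻ u∈ , λ ()
  ∈-successors⁻ {r = y ∷ _} u∈ =
    let u∈′ , u≢y = ∈-filter⁻ (λ u → ¬? (u ≟ y)) u∈ in ∈-neighbours⁻ u∈′ , u≢y ∘ sym ∘ just-injective

  successors-unique : ∀ x r → Unique (successors x r)
  successors-unique x []      = neighbours-unique x
  successors-unique x (y ∷ _) = Uniqueₚ.filter⁺ (λ u → ¬? (u ≟ y)) (neighbours-unique x)

  δ∸1≤length-successors : ∀ x r → δ ∸ 1 ≤ length (successors x r)
  δ∸1≤length-successors x []      = ≤-trans (m∸n≤m δ 1) (δ≤length-neighbours x)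
  δ∸1≤length-successors x (y ∷ _) =
    ∸-monoˡ-≤ 1 (≤-trans (δ≤length-neighbours x) (length-filter-≢ _≟_ y (neighbours-unique x)))

  -- A pair (x , r) stands for the walk x ∷ r, listed from its current end x back to its start.
  extend : V × List V → List (V × List V)
  extend (x , r) = map (λ u → u , x ∷ r) (successors x r)

  extend-unique : ∀ p → Unique (extend p)
  extend-unique (x , r) = Uniqueₚ.map⁺ (cong proj₁) (successors-unique x r)

  extend-disjoint : ∀ {p q} → p ≢ q → Disjoint (extend p) (extend q)
  extend-disjoint p≢q (e∈p , e∈q) with _ , _ , refl ← ∈-map⁻ _ e∈p | _ , _ , eq ← ∈-map⁻ _ e∈q =
    p≢q (cong₂ _,_ (∷-injectiveˡ (cong proj₂ eq)) (∷-injectiveʳ (cong proj₂ eq)))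

  length-extend : ∀ x r → length (extend (x , r)) ≡ length (successors x r)
  length-extend x r = length-map _ (successors x r)

  δ∸1≤length-extend : ∀ p → δ ∸ 1 ≤ length (extend p)
  δ∸1≤length-extend (x , r) = subst (δ ∸ 1 ≤_) (sym (length-extend x r)) (δ∸1≤length-successors x r)

  nonBacktracking : V → ℕ → List (V × List V)
  nonBacktracking t zero    = [ t , [] ]
  nonBacktracking t (suc m) = concatMap extend (nonBacktracking t m)

  nonBacktracking-unique : ∀ t m → Unique (nonBacktracking t m)
  nonBacktracking-unique t zero    = [] ∷ []
  nonBacktracking-unique t (suc m) =
    Uniqueₚ.concat⁺ (Allₚ.map⁺ (All.universal extend-unique _))
                    (AllPairsₚ.map⁺ (AllPairs.map extend-disjoint (nonBacktracking-unique t m)))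

  length-nonBacktracking : ∀ t m → δ * (δ ∸ 1) ^ m ≤ length (nonBacktracking t (suc m))
  length-nonBacktracking t zero = subst (_≤ length (nonBacktracking t 1)) (*-comm 1 δ)
    (length-concatMap-≥ extend {xs = [ t , [] ]}
      λ { (here refl) → subst (δ ≤_) (sym (length-extend t [])) (δ≤length-neighbours t) })
  length-nonBacktracking t (suc m) = begin
    δ * (a * a ^ m)                         ≡⟨ cong (δ *_) (*-comm a (a ^ m)) ⟩
    δ * (a ^ m * a)                         ≡⟨ sym (*-assoc δ (a ^ m) a) ⟩
    δ * a ^ m * a                           ≤⟨ *-monoˡ-≤ a (length-nonBacktracking t m) ⟩
    length (nonBacktracking t (suc m)) * a
      ≤⟨ length-concatMap-≥ extend {xs = nonBacktracking t (suc m)} (λ {p} _ → δ∸1≤length-extend p) ⟩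
    length (nonBacktracking t (suc (suc m))) ∎
    where
    open ≤-Reasoning
    a : ℕ
    a = δ ∸ 1

  PathFrom : V → ℕ → V × List V → Set
  PathFrom t m (x , r) = IsPath (x ∷ r) × length r ≡ m × lastOf x r ≡ t

  PathFrom⇒Walk : ∀ {t m w r} → PathFrom t m (w , r) → Walk G w t m
  PathFrom⇒Walk ((_ , l) , |r|≡m , end) = subst₂ (Walk G _) end |r|≡m (Linked⇒Walk l)

  ends : V → ℕ → List V
  ends t m = map proj₁ (nonBacktracking t m)

  length-ends : ∀ t m → δ * (δ ∸ 1) ^ m ≤ length (ends t (suc m))
  length-ends t m =
    subst (_ ≤_) (sym (length-map proj₁ (nonBacktracking t (suc m)))) (length-nonBacktracking t m)

  module _ {g : ℕ} (girth : GirthAtLeast G g) where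

    ∈-nonBacktracking⁻ : ∀ {t m p} → m < g → p ∈ nonBacktracking t m → PathFrom t m p
    ∈-nonBacktracking⁻ {m = zero}  _   (here refl) = ([] ∷ [] , [-]) , refl , refl
    ∈-nonBacktracking⁻ {t} {suc m} m<g p∈
      with (x , r) , q∈ , p∈ext ← find (∈-concatMap⁻ extend {xs = nonBacktracking t m} p∈)
      with u , u∈ , refl ← ∈-map⁻ _ p∈ext
      with P , refl , refl ← ∈-nonBacktracking⁻ (≤-trans (n≤1+n _) m<g) q∈ =
      let x~u , fresh = ∈-successors⁻ u∈ in path-extension girth P x~u fresh m<g , refl , refl

    ∈-ends⁻ : ∀ {t m w} → m < g → w ∈ ends t m → ∃[ r ] PathFrom t m (w , r)
    ∈-ends⁻ m<g w∈ with (_ , r) , p∈ , refl ← ∈-map⁻ proj₁ w∈ = r , ∈-nonBacktracking⁻ m<g p∈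

    ends-unique : ∀ t m → m + m < g → Unique (ends t m)
    ends-unique t m m+m<g = AllPairsₚ.map⁺ (AllPairs-map∈ distinct (nonBacktracking-unique t m))
      where
      m<g : m < g
      m<g = ≤-trans (s≤s (m≤m+n m m)) m+m<g
      distinct : ∀ {p q} → p ∈ nonBacktracking t m → q ∈ nonBacktracking t m → p ≢ q → proj₁ p ≢ proj₁ q
      distinct {x , r} {.x , r′} p∈ q∈ p≢q refl
        with P , |r| , end ← ∈-nonBacktracking⁻ m<g p∈ | Q , |r′| , end′ ← ∈-nonBacktracking⁻ m<g q∈ =
        <⇒≱ m+m<g (subst (g ≤_) (cong₂ _+_ |r| |r′|)
          (parallel-paths-bound girth P Q (trans end (sym end′)) (p≢q ∘ cong (x ,_))))

-- In terms of the theorem, r = k − 2 and ℓ = k − 1: the girth is at least 2k = 2 + 2ℓ and the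
-- distance bound is 2k − 1 = 1 + 2ℓ.
module MooreBound {n : ℕ} (G : Graph n) (r : ℕ) (girth : GirthAtLeast G (2 + (suc r + suc r)))
  (δ : ℕ) (minDeg : ∀ v → δ ≤ deg G v) (T : Subset n)
  (far : ∀ u v → u ∈ₛ T → v ∈ₛ T → u ≢ v → adj G u v ≡ false → DistAtLeast G u v (1 + (suc r + suc r)))
  where

  open GraphPaths G
  open NonBacktracking G δ minDeg

  ℓ : ℕ
  ℓ = suc r

  g : ℕ
  g = 2 + (ℓ + ℓ)

  2<1+ℓ+ℓ : 2 < suc (ℓ + ℓ)
  2<1+ℓ+ℓ = s≤s (s≤s (≤-trans (s≤s z≤n) (m≤n+m ℓ r)))

  ℓ<g : ℓ < g
  ℓ<g = s≤s (≤-trans (m≤m+n ℓ ℓ) (n≤1+n _))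

  sphere : V → List V
  sphere t = ends t ℓ

  Ts : List V
  Ts = elements T

  spheres-disjoint : ∀ {t t′} → t ∈ Ts → t′ ∈ Ts → t ≢ t′ → Disjoint (sphere t) (sphere t′)
  spheres-disjoint {t} {t′} t∈ t′∈ t≢t′ (w∈ , w∈′)
    with p , P@(P-path , |p| , end) ← ∈-ends⁻ girth ℓ<g w∈
       | p′ , P′@(P′-path , |p′| , end′) ← ∈-ends⁻ girth ℓ<g w∈′
       | adj G t t′ in adjacent
  ... | false = far t t′ (∈-elements⁻ T t∈) (∈-elements⁻ T t′∈) t≢t′ adjacent (ℓ + ℓ) ≤-refl
                  (Walk-++ (Walk-reverse (PathFrom⇒Walk P)) (PathFrom⇒Walk P′))
  ... | true
    with q , Q , endq , |q|≢|p| , |q|≤ ← path-to-neighbour P-path (subst (_~ t′) (sym end) adjacent) =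
    <⇒≱ (s≤s short) (parallel-paths-bound girth Q P′-path (trans endq (sym end′)) q≢p′)
    where
    q≢p′ : q ≢ p′
    q≢p′ q≡p′ = |q|≢|p| (trans (cong length q≡p′) (trans |p′| (sym |p|)))
    short : length q + length p′ ≤ suc (ℓ + ℓ)
    short = +-mono-≤ (subst (λ m → length q ≤ suc m) |p| |q|≤) (≤-reflexive |p′|)

  sphere-unique : ∀ t → Unique (sphere t)
  sphere-unique t = ends-unique girth t ℓ (s≤s (n≤1+n _))

  covered : List V
  covered = concatMap sphere Ts

  covered-unique : Unique covered
  covered-unique = Uniqueₚ.concat⁺ (Allₚ.map⁺ (All.universal sphere-unique Ts))
                                   (AllPairsₚ.map⁺ (AllPairs-map∈ spheres-disjoint (elements-unique T)))

  bound≤length-covered : ∣ T ∣ * δ * (δ ∸ 1) ^ r ≤ length covered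
  bound≤length-covered = begin
    ∣ T ∣ * δ * (δ ∸ 1) ^ r       ≡⟨ *-assoc ∣ T ∣ δ _ ⟩
    ∣ T ∣ * (δ * (δ ∸ 1) ^ r)     ≡⟨ cong (_* _) (sym (length-elements T)) ⟩
    length Ts * (δ * (δ ∸ 1) ^ r) ≤⟨ length-concatMap-≥ sphere {xs = Ts} (λ {t} _ → length-ends t r) ⟩
    length covered                ∎
    where open ≤-Reasoning

  isolated∉covered : ∀ {t₀} → t₀ ∈ Ts → All (λ t → adj G t₀ t ≡ false) Ts → t₀ ∉ covered
  isolated∉covered {t₀} t₀∈ isolated t₀∈covered
    with t , t∈ , t₀∈sphere ← find (∈-concatMap⁻ sphere {xs = Ts} t₀∈covered)
    with p , P@(P-path , |p| , end) ← ∈-ends⁻ girth ℓ<g t₀∈sphere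
    with t₀ ≟ t
  ... | yes refl with () ← trans (sym |p|) (cong length (Unique-lastOf (proj₁ P-path) end))
  ... | no t₀≢t = far t₀ t (∈-elements⁻ T t₀∈) (∈-elements⁻ T t∈) t₀≢t (All.lookup isolated t∈)
                      ℓ (s≤s (m≤m+n ℓ ℓ)) (PathFrom⇒Walk P)

  T-partner-unique : ∀ {x y z} → x ∈ Ts → y ∈ Ts → z ∈ Ts → x ~ y → x ~ z → y ≡ z
  T-partner-unique {x} {y} {z} _ y∈ z∈ x~y x~z with y ≟ z
  ... | yes y≡z = y≡z
  ... | no y≢z with adj G y z in adjacent
  ...   | true  = contradiction (triangle-bound girth x~y adjacent (~-sym x~z)) (<⇒≱ (s≤s 2<1+ℓ+ℓ))
  ...   | false = ⊥-elim (far y z (∈-elements⁻ T y∈) (∈-elements⁻ T z∈) y≢z adjacent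
                               2 2<1+ℓ+ℓ (cons (~-sym x~y) (cons x~z nil)))

  T-perfectlyMatched : (∀ {t₀} → t₀ ∈ Ts → ¬ All (λ t → adj G t₀ t ≡ false) Ts) → PerfectlyMatched _~_ Ts
  T-perfectlyMatched not-isolated = record
    { partner        = λ {x} x∈ →
        let y , y∈ , adj≢false = find (Allₚ.¬All⇒Any¬ (λ t → adj G x t Bool.≟ false) Ts (not-isolated x∈))
        in y , y∈ , ¬-not adj≢false
    ; partner-unique = T-partner-unique
    }

  bound : ∣ T ∣ * δ * (δ ∸ 1) ^ r ≤ n
  bound = ≤-trans bound≤length-covered (Unique⇒length≤ covered-unique)

  bound-odd : ∣ T ∣ % 2 ≡ 1 → ∣ T ∣ * δ * (δ ∸ 1) ^ r + 1 ≤ n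
  bound-odd odd with any? (λ t₀ → all? (λ t → adj G t₀ t Bool.≟ false) Ts) Ts
  ... | yes some-isolated with t₀ , t₀∈ , isolated ← find some-isolated =
    subst (_≤ n) (+-comm 1 _)
      (≤-trans (s≤s bound≤length-covered)
               (Unique⇒length≤ (Unique-∷ (isolated∉covered t₀∈ isolated) covered-unique)))
  ... | no none-isolated = contradiction (trans (sym even) odd) λ ()
    where
    even : ∣ T ∣ % 2 ≡ 0
    even = subst (λ m → m % 2 ≡ 0) (length-elements T)
      (PerfectlyMatched⇒even _~_ ~-sym ~-irrefl (elements-unique T)
        (T-perfectlyMatched (λ t₀∈ → none-isolated ∘ lose t₀∈)))

2*[1+m]≡2+[m+m] : ∀ m → 2 * suc m ≡ 2 + (m + m)
2*[1+m]≡2+[m+m] m = cong suc (trans (cong (m +_) (cong suc (+-identityʳ m))) (+-suc m m))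

lemma2p1 : (k : ℕ) → 2 ≤ k → (n : ℕ) → (G : Graph n) → GirthAtLeast G (2 * k)
    → (δ : ℕ) → IsMinDegree G δ → (T : Subset n)
    → (∀ u v → u ∈ₛ T → v ∈ₛ T → u ≢ v → adj G u v ≡ false → DistAtLeast G u v (2 * k ∸ 1))
    → (∣ T ∣ * δ * (δ ∸ 1) ^ (k ∸ 2) ≤ n)
      × (∣ T ∣ % 2 ≡ 1 → ∣ T ∣ * δ * (δ ∸ 1) ^ (k ∸ 2) + 1 ≤ n)
lemma2p1 (suc zero)    (s≤s ()) _ _ _ _ _ _ _
lemma2p1 (suc (suc j)) _ n G girth δ (minDeg , _) T far = bound , bound-odd
  where
  open MooreBound G j (subst (GirthAtLeast G) (2*[1+m]≡2+[m+m] (suc j)) girth) δ minDeg T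
    (λ u v u∈ v∈ u≢v nonadjacent →
      subst (DistAtLeast G u v) (cong (_∸ 1) (2*[1+m]≡2+[m+m] (suc j))) (far u v u∈ v∈ u≢v nonadjacent))
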